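{- Let $Q$ be a set of $n$ states, $B:\{1,\dots,k\}\to 2^Q$ injective, $q\in Q$ with $\{q\}\notin\mathrm{range}(B)$, and let $B':\{1,\dots,k+1\}\to 2^Q$ be given by $B'(i)=B(i)$ for $i\le k$ and $B'(k+1)=\{q\}$. Then $|T(n,k,B)|\le|T(n,k+1,B')|$.
   Context: For an injective $B:I\to 2^Q$ with $I=\{1,\dots,k\}$ and a finite sequence $\alpha$ over $I$, let $U(\alpha)=\bigcup_i B(\alpha[i])$, $\mathrm{Cover}(\alpha)=\{j\in I: B(j)\subseteq U(\alpha)\}$, and $j\in\mathrm{Mini}(\alpha)$ iff $j\notin\mathrm{Cover}(\alpha)$ and for every $j'\in I\setminus\mathrm{Cover}(\alpha)$, $j'\ne j$ implies $B(j')\cup U(\alpha)\not\subset B(j)\cup U(\alpha)$, and $j'<j$ implies $B(j')\cup U(\alpha)\ne B(j)\cup U(\alpha)$. The tree $T(n,k,B)$ has as nodes the empty sequence (root) and all nonempty sequences $\alpha$ over $I$ with $\alpha[i]\in\mathrm{Mini}(\alpha[1..i-1])$ for all $i$, parent obtained by deleting the last entry; $|T(n,k,B)|$ is its number of non-root nodes. $T(n,k+1,B')$ is defined in the same way using $B'$ and index set $\{1,\dots,k+1\}$. -}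

module Defs where

open import Data.Nat using (ℕ; zero; suc)
open import Data.Fin using (Fin; zero; suc; toℕ; _<_)
open import Data.Fin.Subset using (Subset; _⊆_; _⊂_; _∪_; ⋃)
open import Data.List using (List; []; map; length; lookup; take)
open import Data.List.Membership.Propositional using (_∈_)
open import Data.List.Relation.Unary.Unique.Propositional using (Unique)
open import Data.Product using (_×_)
open import Relation.Binary.PropositionalEquality using (_≡_; _≢_)
open import Relation.Nullary using (¬_)
open import Function.Bundles using (_⇔_)

-- Q = Fin n ; I = Fin k (index i ∈ {1..k} is represented by Fin value i-1,
-- so the order on Fin agrees with the order on I).
module _ {n k : ℕ} (B : Fin k → Subset n) where

  U : List (Fin k) → Subset n
  U α = ⋃ (map B α)

  Cover : List (Fin k) → Fin k → Set
  Cover α j = B j ⊆ U α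

  Mini : List (Fin k) → Fin k → Set
  Mini α j =
    ¬ Cover α j ×
    (∀ (j' : Fin k) → ¬ Cover α j' →
       (j' ≢ j → ¬ ((B j' ∪ U α) ⊂ (B j ∪ U α))) ×
       (j' < j → (B j' ∪ U α) ≢ (B j ∪ U α)))

  IsNode : List (Fin k) → Set
  IsNode α = ∀ (i : Fin (length α)) → Mini (take (toℕ i) α) (lookup α i)

  IsNonRootNode : List (Fin k) → Set
  IsNonRootNode α = α ≢ [] × IsNode α

  -- L is a duplicate-free list of exactly the non-root nodes of T(n,k,B);
  -- then |T(n,k,B)| = length L.
  EnumeratesT : List (List (Fin k)) → Set
  EnumeratesT L = Unique L × (∀ α → (α ∈ L) ⇔ IsNonRootNode α)

-- B' : extend B by a new last value a (index k+1)
extend : {A : Set} {k : ℕ} → (Fin k → A) → A → Fin (suc k) → A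
extend {k = zero}  f a zero    = a
extend {k = suc k} f a zero    = f zero
extend {k = suc k} f a (suc i) = extend (λ x → f (suc x)) a i

-- Every node α of T(n,k,B) is mapped into T(n,k+1,B') by inserting the new index
-- k+1 just before the first entry j with q ∉ U, q ∈ B(j) and B(j) ∪ U ≠ {q} ∪ U,
-- U being the union covered so far.  At that moment {q} is minimal: nothing
-- uncovered lies strictly below {q} ∪ U, and a tie with an earlier index would
-- make B(j) non-minimal.  Afterwards B(j) is still minimal, because adding q ∈ B(j)
-- to U does not change B(j) ∪ U, and the union after j is the same as in α.  At
-- every other entry the new index cannot win: either q is already covered, or
-- {q} ∪ U is not strictly below B(j) ∪ U.  Deleting k+1 recovers α, so the
-- map is injective, which gives |T(n,k,B)| ≤ |T(n,k+1,B')|.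
module Submission where

open import Defs
open import Data.Nat using (ℕ; suc; _≤_)
open import Data.Fin using (Fin)
open import Data.Fin.Subset using (Subset; ⁅_⁆)
open import Data.List using (List; length)
open import Data.Product using (Σ; _×_)
open import Relation.Binary.PropositionalEquality using (_≡_; _≢_)
open import Function.Definitions using (Injective)

open import Data.Nat using (zero; s≤s)
import Data.Nat as ℕ
import Data.Nat.Properties as ℕₚ
open import Data.Bool using () renaming (_≟_ to _≟ᵇ_)
open import Data.Empty using (⊥-elim)
open import Data.Unit using (⊤; tt)
open import Data.Sum using (inj₁; inj₂; [_,_]′)
open import Data.Product using (_,_; proj₁)
open import Data.Fin using (zero; suc; toℕ; inject₁; fromℕ; _<_)
open import Data.Fin.Properties
  using (all?; ¬∀⟶∃¬; injective⇒≤; <-irrefl; <⇒≢; toℕ-inject₁; toℕ-fromℕ; inject₁ℕ<)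
  renaming (_≟_ to _≟ᶠ_; _<?_ to _<ᶠ?_)
open import Data.Fin.Relation.Unary.Top using (view; ‵fromℕ; ‵inject₁; view-fromℕ; view-inject₁)
open import Data.Fin.Subset using (_⊆_; _⊂_; _∪_; _∈_; _∉_; ⊥)
open import Data.Fin.Subset.Properties
  using ( _∈?_; _⊆?_; _⊂?_; ⊆-refl; ⊆-reflexive; ⊆-trans; ⊆-antisym; ⊆-⊂-trans; ⊂-irref
        ; p⊆p∪q; q⊆p∪q; x∈p∪q⁻; x∈⁅x⁆; x∈⁅y⁆⇒x≡y; ∪-assoc; ∪-comm; ∪-identityˡ; ∪-identityʳ )
open import Data.Vec.Properties using (≡-dec)
open import Data.List using ([]; _∷_; map; take; lookup; filter; allFin; cartesianProductWith)
open import Data.List.Properties using (∷-injective; length-map)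
open import Data.List.Membership.Propositional using () renaming (_∈_ to _∈ₗ_)
open import Data.List.Membership.Propositional.Properties
  using ( ∈-lookup; ∈-allFin; ∈-map⁻; ∈-filter⁺; ∈-filter⁻
        ; ∈-cartesianProductWith⁺; ∈-cartesianProductWith⁻ )
open import Data.List.Membership.Setoid.Properties using (index-injective)
open import Data.List.Relation.Unary.All as All using (All; []; _∷_)
open import Data.List.Relation.Unary.AllPairs using ([]; _∷_)
open import Data.List.Relation.Unary.Any using (here; there)
open import Data.List.Relation.Unary.Unique.Propositional using (Unique)
open import Data.List.Relation.Unary.Unique.Propositional.Properties
  using (map⁺; filter⁺; allFin⁺; cartesianProductWith⁺)
open import Relation.Binary.PropositionalEquality
  using (refl; sym; trans; cong; cong₂; subst; subst₂; setoid; module ≡-Reasoning)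
open import Relation.Binary.Definitions using (DecidableEquality)
open import Relation.Nullary using (¬_; Dec; yes; no; contradiction)
open import Relation.Nullary.Decidable using (¬?; _×-dec_; _→-dec_; decidable-stable)
open import Function.Base using (id; _∘_)
open import Function.Bundles using (_⇔_; mk⇔; Equivalence)

module _ {A : Set} where

  lookup-injective : ∀ {xs : List A} → Unique xs → ∀ {i j} → lookup xs i ≡ lookup xs j → i ≡ j
  lookup-injective {_ ∷ _} _ {zero} {zero} _ = refl
  lookup-injective {_ ∷ _} (x∉xs ∷ _) {zero} {suc j} x≡ =
    contradiction x≡ (All.lookup x∉xs (∈-lookup j))
  lookup-injective {_ ∷ _} (x∉xs ∷ _) {suc i} {zero} ≡x =
    contradiction (sym ≡x) (All.lookup x∉xs (∈-lookup i))
  lookup-injective {_ ∷ _} (_ ∷ xs!) {suc i} {suc j} eq = cong suc (lookup-injective xs! eq)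

  Unique⇒length≤ : ∀ {xs ys : List A} → Unique xs → (∀ {x} → x ∈ₗ xs → x ∈ₗ ys) →
                   length xs ≤ length ys
  Unique⇒length≤ xs! xs⊆ys = injective⇒≤ λ {i} {j} eq →
    lookup-injective xs! (index-injective (setoid A) (xs⊆ys (∈-lookup i)) (xs⊆ys (∈-lookup j)) eq)

  lists≤ : List A → ℕ → List (List A)
  lists≤ as zero    = [] ∷ []
  lists≤ as (suc m) = [] ∷ cartesianProductWith _∷_ as (lists≤ as m)

  lists≤-unique : ∀ {as} → Unique as → ∀ m → Unique (lists≤ as m)
  lists≤-unique as! zero    = [] ∷ []
  lists≤-unique {as} as! (suc m) =
    All.tabulate []∉ ∷ cartesianProductWith⁺ _∷_ ∷-injective as! (lists≤-unique as! m)
    where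
    []∉ : ∀ {v} → v ∈ₗ cartesianProductWith _∷_ as (lists≤ as m) → [] ≢ v
    []∉ v∈ with ∈-cartesianProductWith⁻ _∷_ as (lists≤ as m) v∈
    ... | _ , _ , _ , _ , refl = λ ()

  ∈-lists≤ : ∀ {as α m} → All (_∈ₗ as) α → length α ≤ m → α ∈ₗ lists≤ as m
  ∈-lists≤ {m = zero}  []           _         = here refl
  ∈-lists≤ {m = suc m} []           _         = here refl
  ∈-lists≤ {m = suc m} (a∈ ∷ α⊆as) (s≤s α≤m) =
    there (∈-cartesianProductWith⁺ _∷_ a∈ (∈-lists≤ α⊆as α≤m))

private
  variable
    n : ℕ
    o p r s : Subset n
    x : Fin n

infix 4 _≟ₛ_
_≟ₛ_ : DecidableEquality (Subset n)
_≟ₛ_ = ≡-dec _≟ᵇ_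

∪-least : p ⊆ r → o ⊆ r → p ∪ o ⊆ r
∪-least {p = p} {o = o} p⊆r o⊆r = [ p⊆r , o⊆r ]′ ∘ x∈p∪q⁻ p o

∪-monoʳ-⊆ : r ⊆ s → p ∪ r ⊆ p ∪ s
∪-monoʳ-⊆ {s = s} {p = p} r⊆s = ∪-least (p⊆p∪q s) (⊆-trans r⊆s (q⊆p∪q p s))

⊆∧≢⇒⊂ : p ⊆ r → p ≢ r → p ⊂ r
⊆∧≢⇒⊂ {n} {p} {r} p⊆r p≢r with ¬∀⟶∃¬ n (λ y → y ∈ r → y ∈ p) (λ y → y ∈? r →-dec y ∈? p)
                                   (λ r⊆p → p≢r (⊆-antisym p⊆r (r⊆p _)))
... | y , y∈r⇏y∈p =
  p⊆r , y , decidable-stable (y ∈? r) (λ y∉r → y∈r⇏y∈p (⊥-elim ∘ y∉r)) , λ y∈p → y∈r⇏y∈p (λ _ → y∈p)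

x∈p⇒⁅x⁆⊆p : x ∈ p → ⁅ x ⁆ ⊆ p
x∈p⇒⁅x⁆⊆p {x = x} {p = p} x∈p y∈⁅x⁆ = subst (_∈ p) (sym (x∈⁅y⁆⇒x≡y x y∈⁅x⁆)) x∈p

x∈p⇒⁅x⁆∪r⊆p∪r : x ∈ p → ⁅ x ⁆ ∪ r ⊆ p ∪ r
x∈p⇒⁅x⁆∪r⊆p∪r {p = p} {r = r} x∈p = ∪-least (⊆-trans (x∈p⇒⁅x⁆⊆p x∈p) (p⊆p∪q r)) (q⊆p∪q p r)

x∈p⇒⁅x⁆∪p≡p : x ∈ p → ⁅ x ⁆ ∪ p ≡ p
x∈p⇒⁅x⁆∪p≡p x∈p = ⊆-antisym (∪-least (x∈p⇒⁅x⁆⊆p x∈p) ⊆-refl) (q⊆p∪q _ _)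

x∈p⇒p∪[r∪⁅x⁆]≡p∪r : x ∈ p → p ∪ (r ∪ ⁅ x ⁆) ≡ p ∪ r
x∈p⇒p∪[r∪⁅x⁆]≡p∪r {x = x} {p = p} {r = r} x∈p = begin
  p ∪ (r ∪ ⁅ x ⁆)  ≡⟨ cong (p ∪_) (∪-comm r ⁅ x ⁆) ⟩
  p ∪ (⁅ x ⁆ ∪ r)  ≡⟨ sym (∪-assoc p ⁅ x ⁆ r) ⟩
  (p ∪ ⁅ x ⁆) ∪ r  ≡⟨ cong (_∪ r) (∪-comm p ⁅ x ⁆) ⟩
  (⁅ x ⁆ ∪ p) ∪ r  ≡⟨ cong (_∪ r) (x∈p⇒⁅x⁆∪p≡p x∈p) ⟩
  p ∪ r            ∎
  where open ≡-Reasoning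

x∈p⇒[r∪⁅x⁆]∪p≡r∪p : x ∈ p → (r ∪ ⁅ x ⁆) ∪ p ≡ r ∪ p
x∈p⇒[r∪⁅x⁆]∪p≡r∪p {x = x} {r = r} x∈p =
  trans (∪-assoc r ⁅ x ⁆ _) (cong (r ∪_) (x∈p⇒⁅x⁆∪p≡p x∈p))

x∈p⇒p⊆r∪⁅x⁆⇒p∪r≡⁅x⁆∪r : x ∈ p → p ⊆ r ∪ ⁅ x ⁆ → p ∪ r ≡ ⁅ x ⁆ ∪ r
x∈p⇒p⊆r∪⁅x⁆⇒p∪r≡⁅x⁆∪r {x = x} {r = r} x∈p p⊆ = ⊆-antisym
  (∪-least (⊆-trans p⊆ (⊆-reflexive (∪-comm r ⁅ x ⁆))) (q⊆p∪q ⁅ x ⁆ r))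
  (x∈p⇒⁅x⁆∪r⊆p∪r x∈p)

p⊈r⇒p∪r⊄⁅x⁆∪r : ¬ (p ⊆ r) → ¬ (p ∪ r ⊂ ⁅ x ⁆ ∪ r)
p⊈r⇒p∪r⊄⁅x⁆∪r {p = p} {r = r} {x = x} p⊈r (p∪r⊆ , y , y∈⁅x⁆∪r , y∉p∪r) = p⊈r p⊆r
  where
  y≡x : y ≡ x
  y≡x = [ x∈⁅y⁆⇒x≡y x , ⊥-elim ∘ y∉p∪r ∘ q⊆p∪q p r ]′ (x∈p∪q⁻ ⁅ x ⁆ r y∈⁅x⁆∪r)
  p⊆r : p ⊆ r
  p⊆r {z} z∈p with x∈p∪q⁻ ⁅ x ⁆ r (p∪r⊆ (p⊆p∪q r z∈p))
  ... | inj₂ z∈r    = z∈r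
  ... | inj₁ z∈⁅x⁆ =
    ⊥-elim (y∉p∪r (p⊆p∪q r (subst (_∈ p) (trans (x∈⁅y⁆⇒x≡y x z∈⁅x⁆) (sym y≡x)) z∈p)))

Unbeaten : ∀ {k} → Subset n → Subset n → Fin k → Subset n → Fin k → Set
Unbeaten W Y j′ X j = (j′ ≢ j → ¬ (Y ∪ W ⊂ X ∪ W)) × (j′ < j → Y ∪ W ≢ X ∪ W)

unbeaten? : ∀ {k} W Y (j′ : Fin k) X j → Dec (Unbeaten {n} W Y j′ X j)
unbeaten? W Y j′ X j = (¬? (j′ ≟ᶠ j) →-dec ¬? (Y ∪ W ⊂? X ∪ W))
                 ×-dec (j′ <ᶠ? j →-dec ¬? (Y ∪ W ≟ₛ X ∪ W))

unbeaten-refl : ∀ {k} {W X : Subset n} {j : Fin k} → Unbeaten W X j X j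
unbeaten-refl = (λ j≢j → ⊥-elim (j≢j refl)) , (λ j<j → ⊥-elim (<-irrefl refl j<j))

module _ {k} {W Y X : Subset n} {j′ j : Fin k} where

  unbeaten-⊆⇒≡ : Unbeaten W Y j′ X j → j′ ≢ j → Y ∪ W ⊆ X ∪ W → Y ∪ W ≡ X ∪ W
  unbeaten-⊆⇒≡ (¬⊂ , _) j′≢j ⊆ = decidable-stable (_ ≟ₛ _) (¬⊂ j′≢j ∘ ⊆∧≢⇒⊂ ⊆)

  unbeaten-inject₁ : Unbeaten W Y j′ X j → Unbeaten W Y (inject₁ j′) X (inject₁ j)
  unbeaten-inject₁ (¬⊂ , ¬tie) =
    (λ inj≢ → ¬⊂ (inj≢ ∘ cong inject₁)) , (¬tie ∘ subst₂ ℕ._<_ (toℕ-inject₁ j′) (toℕ-inject₁ j))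

  -- enlarging W inside X ∪ W can only remove competitors
  unbeaten-widen : ∀ {W′} → W ⊆ W′ → X ∪ W′ ≡ X ∪ W → Unbeaten W Y j′ X j → Unbeaten W′ Y j′ X j
  unbeaten-widen W⊆W′ X∪W′≡ unbeaten@(¬⊂ , ¬tie) =
    (λ j′≢j ⊂′ → ¬⊂ j′≢j (⊆-⊂-trans (∪-monoʳ-⊆ W⊆W′) (subst (_ ⊂_) X∪W′≡ ⊂′))) ,
    (λ j′<j tie′ → ¬tie j′<j (unbeaten-⊆⇒≡ unbeaten (<⇒≢ j′<j)
      (⊆-trans (∪-monoʳ-⊆ W⊆W′) (⊆-reflexive (trans tie′ X∪W′≡)))))

fromℕ≮inject₁ : ∀ {k} (j : Fin k) → ¬ (fromℕ k < inject₁ j)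
fromℕ≮inject₁ {k} j lt = ℕₚ.<-asym (inject₁ℕ< j) (subst (ℕ._< toℕ (inject₁ j)) (toℕ-fromℕ k) lt)

module Tree {k} (C : Fin k → Subset n) where

  -- Mini C α j is definitionally MiniAt (U C α) j.
  MiniAt : Subset n → Fin k → Set
  MiniAt W j = ¬ (C j ⊆ W) × (∀ j′ → ¬ (C j′ ⊆ W) → Unbeaten W (C j′) j′ (C j) j)

  miniAt? : ∀ W j → Dec (MiniAt W j)
  miniAt? W j = ¬? (C j ⊆? W) ×-dec all? λ j′ → ¬? (C j′ ⊆? W) →-dec unbeaten? W (C j′) j′ (C j) j

  Path : Subset n → List (Fin k) → Set
  Path W []      = ⊤
  Path W (j ∷ α) = MiniAt W j × Path (W ∪ C j) α

  path? : ∀ W α → Dec (Path W α)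
  path? W []      = yes tt
  path? W (j ∷ α) = miniAt? W j ×-dec path? (W ∪ C j) α

  MiniAlong : Subset n → List (Fin k) → Set
  MiniAlong W α = ∀ (i : Fin (length α)) → MiniAt (W ∪ U C (take (toℕ i) α)) (lookup α i)

  path⇒miniAlong : ∀ W α → Path W α → MiniAlong W α
  path⇒miniAlong W (j ∷ α) (mini , _)    zero    =
    subst (λ V → MiniAt V j) (sym (∪-identityʳ W)) mini
  path⇒miniAlong W (j ∷ α) (_    , path) (suc i) =
    subst (λ V → MiniAt V (lookup α i)) (∪-assoc W (C j) _) (path⇒miniAlong (W ∪ C j) α path i)

  miniAlong⇒path : ∀ W α → MiniAlong W α → Path W α
  miniAlong⇒path W []      _    = tt
  miniAlong⇒path W (j ∷ α) mini =
    subst (λ V → MiniAt V j) (∪-identityʳ W) (mini zero) ,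
    miniAlong⇒path (W ∪ C j) α λ i →
      subst (λ V → MiniAt V (lookup α i)) (sym (∪-assoc W (C j) _)) (mini (suc i))

  path⇔isNode : ∀ {α} → Path ⊥ α ⇔ IsNode C α
  path⇔isNode {α} = mk⇔
    (λ path i → subst (λ V → MiniAt V (lookup α i)) (∪-identityˡ _) (path⇒miniAlong ⊥ α path i))
    (λ node → miniAlong⇒path ⊥ α λ i →
      subst (λ V → MiniAt V (lookup α i)) (sym (∪-identityˡ _)) (node i))

  path-uncovered : ∀ {W α j} → Path W α → j ∈ₗ α → ¬ (C j ⊆ W)
  path-uncovered         (mini , _)    (here refl) = proj₁ mini
  path-uncovered {α = i ∷ _} (_ , path) (there j∈α) Cj⊆W =
    path-uncovered path j∈α (⊆-trans Cj⊆W (p⊆p∪q (C i)))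

  path-unique : ∀ {W α} → Path W α → Unique α
  path-unique {α = []}        _             = []
  path-unique {W} {α = j ∷ _} (_ , path) =
    All.tabulate (λ { i∈α refl → path-uncovered path i∈α (q⊆p∪q W (C j)) }) ∷ path-unique path

  path-length≤ : ∀ {W α} → Path W α → length α ≤ k
  path-length≤ path = injective⇒≤ (lookup-injective (path-unique path))

  nonRootNodes : List (List (Fin k))
  nonRootNodes = filter (path? ⊥) (cartesianProductWith _∷_ (allFin k) (lists≤ (allFin k) k))

  nonRootNodes-enumerates : EnumeratesT C nonRootNodes
  nonRootNodes-enumerates =
    filter⁺ (path? ⊥)
      (cartesianProductWith⁺ _∷_ ∷-injective (allFin⁺ k) (lists≤-unique (allFin⁺ k) k)) ,
    λ α → mk⇔ sound complete
    where
    sound : ∀ {α} → α ∈ₗ nonRootNodes → IsNonRootNode C α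
    sound α∈ with ∈-filter⁻ (path? ⊥) α∈
    ... | α∈′ , path with ∈-cartesianProductWith⁻ _∷_ (allFin k) (lists≤ (allFin k) k) α∈′
    ...   | _ , _ , _ , _ , refl = (λ ()) , Equivalence.to path⇔isNode path
    complete : ∀ {α} → IsNonRootNode C α → α ∈ₗ nonRootNodes
    complete {[]}    (α≢[] , _)  = ⊥-elim (α≢[] refl)
    complete {j ∷ β} (_    , node) = ∈-filter⁺ (path? ⊥)
      (∈-cartesianProductWith⁺ _∷_ (∈-allFin j)
        (∈-lists≤ (All.tabulate λ {i} _ → ∈-allFin i)
                  (ℕₚ.≤-trans (ℕₚ.n≤1+n _) (path-length≤ path))))
      path
      where path = Equivalence.from path⇔isNode node

extend-inject₁ : ∀ {A : Set} {k} (f : Fin k → A) a (i : Fin k) → extend f a (inject₁ i) ≡ f i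
extend-inject₁ {k = suc k} f a zero    = refl
extend-inject₁ {k = suc k} f a (suc i) = extend-inject₁ (f ∘ suc) a i

extend-fromℕ : ∀ {A : Set} {k} (f : Fin k → A) a → extend f a (fromℕ k) ≡ a
extend-fromℕ {k = zero}  f a = refl
extend-fromℕ {k = suc k} f a = extend-fromℕ (f ∘ suc) a

module Extension {k} (B : Fin k → Subset n) (q : Fin n) where

  B′ : Fin (suc k) → Subset n
  B′ = extend B ⁅ q ⁆

  open Tree using (MiniAt; Path; path⇔isNode)

  miniAt′-intro : ∀ {W i X} → B′ i ≡ X → ¬ (X ⊆ W) →
    (∀ j → ¬ (B j ⊆ W) → Unbeaten W (B j) (inject₁ j) X i) →
    (¬ (⁅ q ⁆ ⊆ W) → Unbeaten W ⁅ q ⁆ (fromℕ k) X i) →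
    MiniAt B′ W i
  miniAt′-intro {W} {i} refl X⊈W old new = X⊈W , unbeaten
    where
    unbeaten : ∀ i′ → ¬ (B′ i′ ⊆ W) → Unbeaten W (B′ i′) i′ (B′ i) i
    unbeaten i′ with view i′
    ... | ‵fromℕ     rewrite extend-fromℕ B ⁅ q ⁆     = new
    ... | ‵inject₁ j rewrite extend-inject₁ B ⁅ q ⁆ j = old j

  Insert : Subset n → Fin k → Set
  Insert W j = q ∉ W × q ∈ B j × B j ∪ W ≢ ⁅ q ⁆ ∪ W

  insert? : ∀ W j → Dec (Insert W j)
  insert? W j = ¬? (q ∈? W) ×-dec q ∈? B j ×-dec ¬? (B j ∪ W ≟ₛ ⁅ q ⁆ ∪ W)

  module _ {W : Subset n} {j : Fin k} where

    mini-kept : MiniAt B W j → ¬ Insert W j → MiniAt B′ W (inject₁ j)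
    mini-kept (Bj⊈W , unbeaten) ¬insert = miniAt′-intro (extend-inject₁ B ⁅ q ⁆ j) Bj⊈W
      (λ j′ Bj′⊈W → unbeaten-inject₁ (unbeaten j′ Bj′⊈W))
      (λ q⊈W → (λ _ → ¬⊂ q⊈W) , ⊥-elim ∘ fromℕ≮inject₁ j)
      where
      ¬⊂ : ¬ (⁅ q ⁆ ⊆ W) → ¬ (⁅ q ⁆ ∪ W ⊂ B j ∪ W)
      ¬⊂ q⊈W ⊂@(⊆ , _) = ¬insert (q∉W , q∈Bj , λ eq → ⊂-irref (sym eq) ⊂)
        where
        q∉W : q ∉ W
        q∉W q∈W = q⊈W (x∈p⇒⁅x⁆⊆p q∈W)
        q∈Bj : q ∈ B j
        q∈Bj = [ id , ⊥-elim ∘ q∉W ]′ (x∈p∪q⁻ (B j) W (⊆ (p⊆p∪q W (x∈⁅x⁆ q))))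

    mini-inserted : MiniAt B W j → Insert W j → MiniAt B′ W (fromℕ k)
    mini-inserted (_ , unbeaten) (q∉W , q∈Bj , Bj∪W≢) =
      miniAt′-intro (extend-fromℕ B ⁅ q ⁆) (λ q⊆W → q∉W (q⊆W (x∈⁅x⁆ q))) old (λ _ → unbeaten-refl)
      where
      noTie : ∀ j′ → ¬ (B j′ ⊆ W) → B j′ ∪ W ≢ ⁅ q ⁆ ∪ W
      noTie j′ Bj′⊈W tie with j′ ≟ᶠ j
      ... | yes refl = Bj∪W≢ tie
      ... | no j′≢j  = Bj∪W≢ (trans (sym (unbeaten-⊆⇒≡ (unbeaten j′ Bj′⊈W) j′≢j
                         (subst (_⊆ B j ∪ W) (sym tie) (x∈p⇒⁅x⁆∪r⊆p∪r q∈Bj)))) tie)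
      old : ∀ j′ → ¬ (B j′ ⊆ W) → Unbeaten W (B j′) (inject₁ j′) ⁅ q ⁆ (fromℕ k)
      old j′ Bj′⊈W = (λ _ → p⊈r⇒p∪r⊄⁅x⁆∪r Bj′⊈W) , (λ _ → noTie j′ Bj′⊈W)

    mini-afterInserted : MiniAt B W j → Insert W j → MiniAt B′ (W ∪ ⁅ q ⁆) (inject₁ j)
    mini-afterInserted (_ , unbeaten) (_ , q∈Bj , Bj∪W≢) =
      miniAt′-intro (extend-inject₁ B ⁅ q ⁆ j) (Bj∪W≢ ∘ x∈p⇒p⊆r∪⁅x⁆⇒p∪r≡⁅x⁆∪r q∈Bj) old
        (λ q⊈W∪q → ⊥-elim (q⊈W∪q (q⊆p∪q W ⁅ q ⁆)))
      where
      old : ∀ j′ → ¬ (B j′ ⊆ W ∪ ⁅ q ⁆) → Unbeaten (W ∪ ⁅ q ⁆) (B j′) (inject₁ j′) (B j) (inject₁ j)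
      old j′ Bj′⊈W∪q = unbeaten-inject₁ (unbeaten-widen (p⊆p∪q ⁅ q ⁆) (x∈p⇒p∪[r∪⁅x⁆]≡p∪r q∈Bj)
        (unbeaten j′ λ Bj′⊆W → Bj′⊈W∪q (⊆-trans Bj′⊆W (p⊆p∪q ⁅ q ⁆))))

  embed : Subset n → List (Fin k) → List (Fin (suc k))
  embed W []      = []
  embed W (j ∷ α) with insert? W j
  ... | yes _ = fromℕ k ∷ inject₁ j ∷ embed (W ∪ B j) α
  ... | no  _ = inject₁ j ∷ embed (W ∪ B j) α

  dropNew : List (Fin (suc k)) → List (Fin k)
  dropNew []      = []
  dropNew (i ∷ α) with view i
  ... | ‵fromℕ     = dropNew α
  ... | ‵inject₁ j = j ∷ dropNew α

  dropNew-embed : ∀ W α → dropNew (embed W α) ≡ α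
  dropNew-embed W []      = refl
  dropNew-embed W (j ∷ α) with insert? W j
  ... | yes _ rewrite view-fromℕ k | view-inject₁ j = cong (j ∷_) (dropNew-embed (W ∪ B j) α)
  ... | no  _ rewrite view-inject₁ j                 = cong (j ∷_) (dropNew-embed (W ∪ B j) α)

  embed-injective : ∀ W {α β} → embed W α ≡ embed W β → α ≡ β
  embed-injective W {α} {β} eq =
    trans (sym (dropNew-embed W α)) (trans (cong dropNew eq) (dropNew-embed W β))

  union-afterInserted : ∀ {W j} → q ∈ B j → (W ∪ B′ (fromℕ k)) ∪ B′ (inject₁ j) ≡ W ∪ B j
  union-afterInserted {W} {j} q∈Bj =
    trans (cong₂ (λ Y X → (W ∪ Y) ∪ X) (extend-fromℕ B ⁅ q ⁆) (extend-inject₁ B ⁅ q ⁆ j))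
          (x∈p⇒[r∪⁅x⁆]∪p≡r∪p q∈Bj)

  embed-path : ∀ W α → Path B W α → Path B′ W (embed W α)
  embed-path W []      _             = tt
  embed-path W (j ∷ α) (mini , path) with insert? W j
  ... | yes insert@(_ , q∈Bj , _) =
    mini-inserted mini insert ,
    subst (λ V → MiniAt B′ (W ∪ V) (inject₁ j)) (sym (extend-fromℕ B ⁅ q ⁆))
      (mini-afterInserted mini insert) ,
    subst (λ V → Path B′ V (embed (W ∪ B j) α)) (sym (union-afterInserted q∈Bj))
      (embed-path (W ∪ B j) α path)
  ... | no ¬insert =
    mini-kept mini ¬insert ,
    subst (λ V → Path B′ (W ∪ V) (embed (W ∪ B j) α)) (sym (extend-inject₁ B ⁅ q ⁆ j))
      (embed-path (W ∪ B j) α path)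

  embed-nonRootNode : ∀ {α} → IsNonRootNode B α → IsNonRootNode B′ (embed ⊥ α)
  embed-nonRootNode {α} (α≢[] , node) =
    α≢[] ∘ embed-injective ⊥ ,
    Equivalence.to (path⇔isNode B′) (embed-path ⊥ α (Equivalence.from (path⇔isNode B) node))

  enumeratesT-length≤ : ∀ {L L′} → EnumeratesT B L → EnumeratesT B′ L′ → length L ≤ length L′
  enumeratesT-length≤ {L} {L′} (L! , L≈) (_ , L′≈) = begin
    length L                 ≡⟨ length-map (embed ⊥) L ⟨
    length (map (embed ⊥) L) ≤⟨ Unique⇒length≤ (map⁺ (embed-injective ⊥) L!) embedded∈L′ ⟩
    length L′                ∎
    where
    open ℕₚ.≤-Reasoning
    embedded∈L′ : ∀ {α′} → α′ ∈ₗ map (embed ⊥) L → α′ ∈ₗ L′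
    embedded∈L′ α′∈ with ∈-map⁻ (embed ⊥) α′∈
    ... | α , α∈L , refl = Equivalence.from (L′≈ _) (embed-nonRootNode (Equivalence.to (L≈ α) α∈L))

mainTheorem7 : (n k : ℕ) (B : Fin k → Subset n) → Injective _≡_ _≡_ B →
    (q : Fin n) → (∀ i → B i ≢ ⁅ q ⁆) →
    (Σ (List (List (Fin k))) (EnumeratesT B)) ×
    (Σ (List (List (Fin (suc k)))) (EnumeratesT (extend B ⁅ q ⁆))) ×
    (∀ (L : List (List (Fin k))) (L' : List (List (Fin (suc k)))) →
       EnumeratesT B L → EnumeratesT (extend B ⁅ q ⁆) L' →
       length L ≤ length L')
mainTheorem7 n k B _ q _ =
  (_ , Tree.nonRootNodes-enumerates B) ,
  (_ , Tree.nonRootNodes-enumerates (extend B ⁅ q ⁆)) ,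
  λ _ _ → Extension.enumeratesT-length≤ B q
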